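{- Let $k\ge1$, $h$ an integer, and $\alpha\in\Sigma_p(k,h)$. If $2\langle\rho_p,\alpha^\vee\rangle=m\in\mathbb{Z}$, then $2h=kc_p+m$. In particular, if $\alpha\in\Sigma_p(k,h)$ with $h<kc_p/2$ (resp. $h>kc_p/2$), then $\langle\rho_p,\alpha^\vee\rangle<0$ (resp. $>0$).
   Context: Let $\Phi$ be a reduced irreducible root system of rank $r$ in a real inner product space, with fundamental system $\Delta=\{\alpha_1,\dots,\alpha_r\}$, positive roots $\Phi^+$, coroots $\alpha^\vee=2\alpha/\langle\alpha,\alpha\rangle$, fundamental weights $\lambda_i$ with $\langle\lambda_i,\alpha_j^\vee\rangle=\delta_{ij}$, $\rho=\frac12\sum_{\alpha\in\Phi^+}\alpha$, $\mathrm{ht}\,\alpha^\vee=\langle\rho,\alpha^\vee\rangle$. Fix $1\le p\le r$; $\Phi_p=\{\alpha\in\Phi:\langle\lambda_p,\alpha^\vee\rangle=0\}$, $\Phi_p^+=\Phi_p\cap\Phi^+$, $\rho_p=\frac12\sum_{\alpha\in\Phi_p^+}\alpha$, $c_p=2\langle\lambda_p-\rho_p,\alpha_p^\vee\rangle$, and $\Sigma_p(k,h)=\{\alpha\in\Phi:\langle\lambda_p,\alpha^\vee\rangle=k,\ \mathrm{ht}\,\alpha^\vee=h\}$.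
   Formalization: The root system Φ lies in some ℚ^n with the standard inner product rather than in a real inner product space. -}

module Defs where

open import Data.Nat using (ℕ; zero; suc)
open import Data.Integer using (ℤ; +_) renaming (_≤_ to _≤ℤ_)
open import Data.Rational using (ℚ; 0ℚ; 1ℚ; ½; _+_; _*_; _-_; -_; _/_; 1/_; ≢-nonZero)
open import Data.Rational.Properties using (_≟_)
open import Data.Fin using (Fin; _≟_)
open import Data.Vec using (Vec; []; _∷_; zipWith; map; replicate; foldr)
open import Data.List using (List; filter)
open import Data.List.Membership.Propositional using (_∈_)
open import Data.Product using (Σ; _×_; ∃)
open import Data.Sum using (_⊎_)
open import Data.Bool using (Bool; true; false)
open import Relation.Nullary using (¬_; yes; no)
open import Relation.Binary.PropositionalEquality using (_≡_)

V : ℕ → Set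
V n = Vec ℚ n

0V : ∀ {n} → V n
0V = replicate _ 0ℚ

infixl 6 _⊕_ _⊖_
_⊕_ : ∀ {n} → V n → V n → V n
_⊕_ = zipWith _+_

_·_ : ∀ {n} → ℚ → V n → V n
c · v = map (c *_) v

_⊖_ : ∀ {n} → V n → V n → V n
u ⊖ v = u ⊕ ((- 1ℚ) · v)

⟪_,_⟫ : ∀ {n} → V n → V n → ℚ
⟪ u , v ⟫ = foldr _ _+_ 0ℚ (zipWith _*_ u v)

-- total inverse (0 ↦ 0); only ever applied to ⟪α,α⟫ with α ≠ 0
inv : ℚ → ℚ
inv q with q Data.Rational.Properties.≟ 0ℚ
... | yes _ = 0ℚ
... | no q≢0 = 1/_ q {{≢-nonZero q≢0}}

ι : ℤ → ℚ
ι z = z / 1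

_^∨ : ∀ {n} → V n → V n
α ^∨ = (ι (+ 2) * inv ⟪ α , α ⟫) · α

⟨_,_⟩∨ : ∀ {n} → V n → V n → ℚ
⟨ v , α ⟩∨ = ⟪ v , α ^∨ ⟫

s : ∀ {n} → V n → V n → V n
s α v = v ⊖ (⟨ v , α ⟩∨ · α)

sumV : ∀ {n r} → (Fin r → V n) → V n
sumV {r = zero} f = 0V
sumV {r = suc r} f = f Fin.zero ⊕ sumV (λ i → f (Fin.suc i))

sumL : ∀ {n} → List (V n) → V n
sumL = Data.List.foldr _⊕_ 0V

lincomb : ∀ {n r} → (Fin r → ℚ) → (Fin r → V n) → V n
lincomb c Δ = sumV (λ i → c i · Δ i)

record IsRootSystem {n : ℕ} (Φ : List (V n)) : Set where
  field
    zero∉    : ¬ (0V ∈ Φ)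
    reflect  : ∀ {α β} → α ∈ Φ → β ∈ Φ → s α β ∈ Φ
    integral : ∀ {α β} → α ∈ Φ → β ∈ Φ → ∃ λ (z : ℤ) → ⟨ β , α ⟩∨ ≡ ι z
    reduced  : ∀ {α} (c : ℚ) → α ∈ Φ → (c · α) ∈ Φ → (c ≡ 1ℚ) ⊎ (c ≡ - 1ℚ)

Irreducible : ∀ {n} → List (V n) → Set
Irreducible {n} Φ = (f : V n → Bool) →
  (∀ {α β} → α ∈ Φ → β ∈ Φ → f α ≡ true → f β ≡ false → ⟪ α , β ⟫ ≡ 0ℚ) →
  (∀ {α} → α ∈ Φ → f α ≡ true) ⊎ (∀ {α} → α ∈ Φ → f α ≡ false)

-- α is a ℤ-combination of Δ with all coefficients ≥ 0 (i.e. α ∈ Φ⁺ when α ∈ Φ)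
NonnegComb : ∀ {n r} → (Fin r → V n) → V n → Set
NonnegComb Δ α = Σ (Fin _ → ℤ) λ c → (∀ i → + 0 ≤ℤ c i) × (α ≡ lincomb (λ i → ι (c i)) Δ)

NonposComb : ∀ {n r} → (Fin r → V n) → V n → Set
NonposComb Δ α = Σ (Fin _ → ℤ) λ c → (∀ i → c i ≤ℤ + 0) × (α ≡ lincomb (λ i → ι (c i)) Δ)

InSpan : ∀ {n r} → (Fin r → V n) → V n → Set
InSpan Δ v = Σ (Fin _ → ℚ) λ c → v ≡ lincomb c Δ

record IsFundamentalSystem {n r : ℕ} (Φ : List (V n)) (Δ : Fin r → V n) : Set where
  field
    inΦ     : ∀ i → Δ i ∈ Φ
    linInd  : ∀ (c : Fin r → ℚ) → lincomb c Δ ≡ 0V → ∀ i → c i ≡ 0ℚ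
    signed  : ∀ {α} → α ∈ Φ → NonnegComb Δ α ⊎ NonposComb Δ α

δ : ∀ {r} → Fin r → Fin r → ℚ
δ i j with i Data.Fin.≟ j
... | yes _ = 1ℚ
... | no _ = 0ℚ

Φp⁺ : ∀ {n} → V n → List (V n) → List (V n)
Φp⁺ λp Φ⁺ = filter (λ α → ⟨ λp , α ⟩∨ Data.Rational.Properties.≟ 0ℚ) Φ⁺

ρ : ∀ {n} → List (V n) → V n
ρ Φ⁺ = ½ · sumL Φ⁺

ρp : ∀ {n} → V n → List (V n) → V n
ρp λp Φ⁺ = ½ · sumL (Φp⁺ λp Φ⁺)

cp : ∀ {n} → V n → V n → List (V n) → ℚ
cp λp αp Φ⁺ = ι (+ 2) * ⟨ λp ⊖ ρp λp Φ⁺ , αp ⟩∨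

{-# OPTIONS --safe #-}
-- Both ρ and ρ_p are half-sums of positive roots that a simple reflection s_j permutes apart
-- from α_j itself (for ρ_p when j ≠ p), so ⟨ρ, α_j^∨⟩ = 1 for every j and ⟨ρ_p, α_j^∨⟩ = 1
-- for j ≠ p. Together with the definition of c_p this makes ρ − ρ_p − (c_p/2) λ_p orthogonal
-- to every simple root, hence to every root; pairing with α^∨ gives h = ⟨ρ_p, α^∨⟩ + k c_p/2,
-- which is the first claim, and the sign statements follow.
module Submission where

open import Defs
open import Data.Nat using (ℕ)
open import Data.Integer using (ℤ; +_; _≤_)
open import Data.Rational using (ℚ; 0ℚ; ½; _+_; _*_; _<_)
open import Data.Fin using (Fin)
open import Data.List using (List)
open import Data.List.Membership.Propositional using (_∈_)
open import Data.List.Relation.Unary.Unique.Propositional using (Unique)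
open import Data.Product using (_×_)
open import Function.Bundles using (_⇔_)
open import Relation.Binary.PropositionalEquality using (_≡_)

open import Data.Nat using (zero; suc; z≤n)
open import Data.Integer using (-[1+_]; +≤+)
open import Data.Rational using (1ℚ; -_; _-_; 1/_; NonZero; ≢-nonZero; nonNegative; nonPositive; *≤*)
  renaming (_≤_ to _≤ℚ_)
import Data.Rational.Properties as ℚP
open import Algebra.Properties.Ring ℚP.+-*-ring using (-1*x≈-x)
open import Data.Rational.Solver using (module +-*-Solver)
open +-*-Solver using (solve; _:=_; _:+_; _:*_; _:-_; :-_; con)
import Data.Fin as F
import Data.Fin.Properties as FP
open import Function using (_∘_)
open import Data.Vec using ([]; _∷_)
import Data.Vec.Properties as VecP
open import Data.List using ([]; _∷_; foldr; map; filter)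
import Data.List.Properties as ListP
open import Data.List.Membership.Propositional using (_∉_)
open import Data.List.Membership.Propositional.Properties using (∈-filter⁺; ∈-filter⁻; ∈-map⁺; ∈-map⁻)
open import Data.List.Membership.Propositional.Properties.WithK using (unique∧set⇒bag)
open import Data.List.Relation.Binary.BagAndSetEquality using (∼bag⇒↭)
open import Data.List.Relation.Binary.Permutation.Propositional using (_↭_; ↭⇒↭ₛ)
open import Data.List.Relation.Binary.Permutation.Propositional.Properties using (map⁺)
open import Data.List.Relation.Binary.Permutation.Setoid.Properties using (foldr-commMonoid)
import Data.List.Relation.Unary.Unique.Propositional.Properties as UniqueP
open import Data.List.Relation.Unary.Any using (here; there)
open import Data.List.Relation.Unary.All using (tabulate)
open import Data.List.Relation.Unary.AllPairs using (_∷_)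
open import Data.Product using (_,_; proj₁; proj₂)
open import Data.Sum using (_⊎_; inj₁; inj₂)
open import Data.Empty using (⊥; ⊥-elim)
open import Function.Bundles using (mk⇔; Equivalence)
open import Relation.Nullary using (¬_; Dec; yes; no; ¬?)
open import Relation.Binary.PropositionalEquality
  using (_≢_; refl; sym; trans; cong; cong₂; subst; subst₂; setoid; module ≡-Reasoning)

variable
  n r : ℕ

⊕-identityˡ : (v : V n) → 0V ⊕ v ≡ v
⊕-identityˡ [] = refl
⊕-identityˡ (x ∷ v) = cong₂ _∷_ (ℚP.+-identityˡ x) (⊕-identityˡ v)

⊕-identityʳ : (v : V n) → v ⊕ 0V ≡ v
⊕-identityʳ [] = refl
⊕-identityʳ (x ∷ v) = cong₂ _∷_ (ℚP.+-identityʳ x) (⊕-identityʳ v)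

⊕-interchange : (u v w x : V n) → (u ⊕ v) ⊕ (w ⊕ x) ≡ (u ⊕ w) ⊕ (v ⊕ x)
⊕-interchange [] [] [] [] = refl
⊕-interchange (a ∷ u) (b ∷ v) (c ∷ w) (d ∷ x) = cong₂ _∷_
  (solve 4 (λ a b c d → (a :+ b) :+ (c :+ d) := (a :+ c) :+ (b :+ d)) refl a b c d)
  (⊕-interchange u v w x)

·-distribʳ : (a b : ℚ) (v : V n) → (a + b) · v ≡ a · v ⊕ b · v
·-distribʳ a b [] = refl
·-distribʳ a b (x ∷ v) = cong₂ _∷_ (ℚP.*-distribʳ-+ x a b) (·-distribʳ a b v)

·-distribˡ : (q : ℚ) (u v : V n) → q · (u ⊕ v) ≡ q · u ⊕ q · v
·-distribˡ q [] [] = refl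
·-distribˡ q (x ∷ u) (y ∷ v) = cong₂ _∷_ (ℚP.*-distribˡ-+ q x y) (·-distribˡ q u v)

·-assoc : (p q : ℚ) (v : V n) → p · (q · v) ≡ (p * q) · v
·-assoc p q [] = refl
·-assoc p q (x ∷ v) = cong₂ _∷_ (sym (ℚP.*-assoc p q x)) (·-assoc p q v)

·-zeroˡ : (v : V n) → 0ℚ · v ≡ 0V
·-zeroˡ [] = refl
·-zeroˡ (x ∷ v) = cong₂ _∷_ (ℚP.*-zeroˡ x) (·-zeroˡ v)

·-zeroʳ : (q : ℚ) → q · 0V {n} ≡ 0V
·-zeroʳ {zero} q = refl
·-zeroʳ {suc n} q = cong₂ _∷_ (ℚP.*-zeroʳ q) (·-zeroʳ q)

·-identityˡ : (v : V n) → 1ℚ · v ≡ v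
·-identityˡ [] = refl
·-identityˡ (x ∷ v) = cong₂ _∷_ (ℚP.*-identityˡ x) (·-identityˡ v)

⊖-self : (v : V n) → v ⊖ v ≡ 0V
⊖-self [] = refl
⊖-self (x ∷ v) = cong₂ _∷_ (solve 1 (λ x → x :+ :- con 1ℚ :* x := con 0ℚ) refl x) (⊖-self v)

⊖-⊖-neg : (t : ℚ) (v a : V n) → (v ⊖ t · a) ⊖ (- t) · a ≡ v
⊖-⊖-neg t [] [] = refl
⊖-⊖-neg t (x ∷ v) (y ∷ a) = cong₂ _∷_
  (solve 3 (λ x t y → (x :+ :- con 1ℚ :* (t :* y)) :+ :- con 1ℚ :* (:- t :* y) := x) refl x t y)
  (⊖-⊖-neg t v a)

⊖-double : (v : V n) → v ⊖ (1ℚ + 1ℚ) · v ≡ (- 1ℚ) · v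
⊖-double [] = refl
⊖-double (x ∷ v) = cong₂ _∷_
  (solve 1 (λ x → x :+ :- con 1ℚ :* ((con 1ℚ :+ con 1ℚ) :* x) := :- con 1ℚ :* x) refl x)
  (⊖-double v)

⟪,⟫-comm : (u v : V n) → ⟪ u , v ⟫ ≡ ⟪ v , u ⟫
⟪,⟫-comm [] [] = refl
⟪,⟫-comm (x ∷ u) (y ∷ v) = cong₂ _+_ (ℚP.*-comm x y) (⟪,⟫-comm u v)

⟪,⟫-⊕ˡ : (u v w : V n) → ⟪ u ⊕ v , w ⟫ ≡ ⟪ u , w ⟫ + ⟪ v , w ⟫
⟪,⟫-⊕ˡ [] [] [] = refl
⟪,⟫-⊕ˡ (x ∷ u) (y ∷ v) (z ∷ w) rewrite ⟪,⟫-⊕ˡ u v w =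
  solve 5 (λ x y z U V → (x :+ y) :* z :+ (U :+ V) := (x :* z :+ U) :+ (y :* z :+ V))
    refl x y z ⟪ u , w ⟫ ⟪ v , w ⟫

⟪,⟫-·ˡ : (c : ℚ) (u w : V n) → ⟪ c · u , w ⟫ ≡ c * ⟪ u , w ⟫
⟪,⟫-·ˡ c [] [] = sym (ℚP.*-zeroʳ c)
⟪,⟫-·ˡ c (x ∷ u) (z ∷ w) rewrite ⟪,⟫-·ˡ c u w =
  solve 4 (λ c x z U → (c :* x) :* z :+ c :* U := c :* (x :* z :+ U)) refl c x z ⟪ u , w ⟫

⟪,⟫-0Vˡ : (w : V n) → ⟪ 0V , w ⟫ ≡ 0ℚ
⟪,⟫-0Vˡ [] = refl
⟪,⟫-0Vˡ (z ∷ w) rewrite ⟪,⟫-0Vˡ w = trans (ℚP.+-identityʳ _) (ℚP.*-zeroˡ z)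

⟪,⟫-⊕ʳ : (w u v : V n) → ⟪ w , u ⊕ v ⟫ ≡ ⟪ w , u ⟫ + ⟪ w , v ⟫
⟪,⟫-⊕ʳ w u v = trans (⟪,⟫-comm w _) (trans (⟪,⟫-⊕ˡ u v w) (cong₂ _+_ (⟪,⟫-comm u w) (⟪,⟫-comm v w)))

⟪,⟫-·ʳ : (c : ℚ) (w u : V n) → ⟪ w , c · u ⟫ ≡ c * ⟪ w , u ⟫
⟪,⟫-·ʳ c w u = trans (⟪,⟫-comm w _) (trans (⟪,⟫-·ˡ c u w) (cong (c *_) (⟪,⟫-comm u w)))

⟪,⟫-⊖ˡ : (u v w : V n) → ⟪ u ⊖ v , w ⟫ ≡ ⟪ u , w ⟫ - ⟪ v , w ⟫
⟪,⟫-⊖ˡ u v w = trans (⟪,⟫-⊕ˡ u _ w) (cong (_+_ ⟪ u , w ⟫) (trans (⟪,⟫-·ˡ (- 1ℚ) v w) (-1*x≈-x _)))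

⟪,⟫-⊖ʳ : (w u v : V n) → ⟪ w , u ⊖ v ⟫ ≡ ⟪ w , u ⟫ - ⟪ w , v ⟫
⟪,⟫-⊖ʳ w u v = trans (⟪,⟫-comm w _) (trans (⟪,⟫-⊖ˡ u v w) (cong₂ _-_ (⟪,⟫-comm u w) (⟪,⟫-comm v w)))

x*x≥0 : (x : ℚ) → 0ℚ ≤ℚ x * x
x*x≥0 x with ℚP.≤-total 0ℚ x
... | inj₁ 0≤x = ℚP.nonNegative⁻¹ _ {{ℚP.nonNeg*nonNeg⇒nonNeg x {{nonNegative 0≤x}} x {{nonNegative 0≤x}}}}
... | inj₂ x≤0 = ℚP.nonNegative⁻¹ _ {{ℚP.nonPos*nonPos⇒nonPos x {{nonPositive x≤0}} x {{nonPositive x≤0}}}}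

x*x≡0⇒x≡0 : (x : ℚ) → x * x ≡ 0ℚ → x ≡ 0ℚ
x*x≡0⇒x≡0 x x*x≡0 with x ℚP.≟ 0ℚ
... | yes x≡0 = x≡0
... | no x≢0 = ⊥-elim (ℚP.1≢0 (begin
    1ℚ                ≡⟨ sym (cong₂ _*_ (ℚP.*-inverseˡ x) (ℚP.*-inverseˡ x)) ⟩
    (y * x) * (y * x) ≡⟨ solve 2 (λ y x → (y :* x) :* (y :* x) := (y :* y) :* (x :* x)) refl y x ⟩
    (y * y) * (x * x) ≡⟨ cong ((y * y) *_) x*x≡0 ⟩
    (y * y) * 0ℚ      ≡⟨ ℚP.*-zeroʳ (y * y) ⟩
    0ℚ                ∎))
  where
  open ≡-Reasoning
  instance
    x-nonZero : NonZero x
    x-nonZero = ≢-nonZero x≢0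
  y : ℚ
  y = 1/ x

x+y≡0⇒x≡0×y≡0 : {x y : ℚ} → 0ℚ ≤ℚ x → 0ℚ ≤ℚ y → x + y ≡ 0ℚ → x ≡ 0ℚ × y ≡ 0ℚ
x+y≡0⇒x≡0×y≡0 {x} {y} 0≤x 0≤y x+y≡0 = ℚP.≤-antisym x≤0 0≤x , ℚP.≤-antisym y≤0 0≤y
  where
  x≤0 : x ≤ℚ 0ℚ
  x≤0 = subst₂ _≤ℚ_ (ℚP.+-identityʳ x) x+y≡0 (ℚP.+-monoʳ-≤ x 0≤y)
  y≤0 : y ≤ℚ 0ℚ
  y≤0 = subst₂ _≤ℚ_ (ℚP.+-identityˡ y) x+y≡0 (ℚP.+-monoˡ-≤ y 0≤x)

⟪v,v⟫≥0 : (v : V n) → 0ℚ ≤ℚ ⟪ v , v ⟫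
⟪v,v⟫≥0 [] = ℚP.≤-refl
⟪v,v⟫≥0 (x ∷ v) = ℚP.+-mono-≤ (x*x≥0 x) (⟪v,v⟫≥0 v)

⟪v,v⟫≡0⇒v≡0V : (v : V n) → ⟪ v , v ⟫ ≡ 0ℚ → v ≡ 0V
⟪v,v⟫≡0⇒v≡0V [] _ = refl
⟪v,v⟫≡0⇒v≡0V (x ∷ v) ⟪v,v⟫≡0 with x+y≡0⇒x≡0×y≡0 (x*x≥0 x) (⟪v,v⟫≥0 v) ⟪v,v⟫≡0
... | x*x≡0 , rest≡0 = cong₂ _∷_ (x*x≡0⇒x≡0 x x*x≡0) (⟪v,v⟫≡0⇒v≡0V v rest≡0)

ι-nonneg : (z : ℤ) → + 0 ≤ z → 0ℚ ≤ℚ ι z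
ι-nonneg (+ m) _ = ℚP.nonNegative⁻¹ (ι (+ m)) {{ℚP.normalize-nonNeg m 1}}

ι-nonpos : (z : ℤ) → z ≤ + 0 → ι z ≤ℚ 0ℚ
ι-nonpos (+ zero) _ = ℚP.≤-refl
ι-nonpos (+ suc m) (+≤+ ())
ι-nonpos -[1+ m ] _ = ℚP.neg-antimono-≤ (ι-nonneg (+ suc m) (+≤+ z≤n))

0≰-1 : ¬ (0ℚ ≤ℚ - 1ℚ)
0≰-1 (*≤* ())

inv-inverseˡ : (q : ℚ) → q ≢ 0ℚ → inv q * q ≡ 1ℚ
inv-inverseˡ q q≢0 with q ℚP.≟ 0ℚ
... | yes q≡0 = ⊥-elim (q≢0 q≡0)
... | no q≢0′ = ℚP.*-inverseˡ q {{≢-nonZero q≢0′}}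

x≡-x⇒x≡0 : (x : ℚ) → x ≡ - x → x ≡ 0ℚ
x≡-x⇒x≡0 x x≡-x = begin
  x             ≡⟨ solve 1 (λ x → x := con ½ :* (x :+ x)) refl x ⟩
  ½ * (x + x)   ≡⟨ cong (λ y → ½ * (x + y)) x≡-x ⟩
  ½ * (x + - x) ≡⟨ solve 1 (λ x → con ½ :* (x :+ :- x) := con 0ℚ) refl x ⟩
  0ℚ            ∎
  where open ≡-Reasoning

-- Coroot pairings and reflections

⟨,⟩∨-⊖ˡ : (u v α : V n) → ⟨ u ⊖ v , α ⟩∨ ≡ ⟨ u , α ⟩∨ - ⟨ v , α ⟩∨
⟨,⟩∨-⊖ˡ u v α = ⟪,⟫-⊖ˡ u v (α ^∨)

⟨,⟩∨-·ˡ : (q : ℚ) (u α : V n) → ⟨ q · u , α ⟩∨ ≡ q * ⟨ u , α ⟩∨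
⟨,⟩∨-·ˡ q u α = ⟪,⟫-·ˡ q u (α ^∨)

⟪,⟫≡0⇒⟨,⟩∨≡0 : (v α : V n) → ⟪ v , α ⟫ ≡ 0ℚ → ⟨ v , α ⟩∨ ≡ 0ℚ
⟪,⟫≡0⇒⟨,⟩∨≡0 v α v⊥α = trans (⟪,⟫-·ʳ c v α) (trans (cong (c *_) v⊥α) (ℚP.*-zeroʳ c))
  where
  c : ℚ
  c = ι (+ 2) * inv ⟪ α , α ⟫

⟪,s⟫≡⟪,⟫ : (u α β : V n) → ⟪ u , α ⟫ ≡ 0ℚ → ⟪ u , s α β ⟫ ≡ ⟪ u , β ⟫
⟪,s⟫≡⟪,⟫ u α β u⊥α = begin
  ⟪ u , s α β ⟫                ≡⟨ ⟪,⟫-⊖ʳ u β (t · α) ⟩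
  ⟪ u , β ⟫ - ⟪ u , t · α ⟫    ≡⟨ cong (λ x → ⟪ u , β ⟫ - x) (trans (⟪,⟫-·ʳ t u α) (cong (t *_) u⊥α)) ⟩
  ⟪ u , β ⟫ - t * 0ℚ           ≡⟨ solve 2 (λ x t → x :- t :* con 0ℚ := x) refl ⟪ u , β ⟫ t ⟩
  ⟪ u , β ⟫                    ∎
  where
  open ≡-Reasoning
  t : ℚ
  t = ⟨ β , α ⟩∨

module Coroot (α : V n) (α≢0 : ⟪ α , α ⟫ ≢ 0ℚ) where

  κ : ℚ
  κ = ι (+ 2) * inv ⟪ α , α ⟫

  ⟨,⟩∨≡κ* : (v : V n) → ⟨ v , α ⟩∨ ≡ κ * ⟪ v , α ⟫
  ⟨,⟩∨≡κ* v = ⟪,⟫-·ʳ κ v α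

  κ*⟪α,α⟫≡2 : κ * ⟪ α , α ⟫ ≡ 1ℚ + 1ℚ
  κ*⟪α,α⟫≡2 = trans (ℚP.*-assoc (ι (+ 2)) (inv ⟪ α , α ⟫) ⟪ α , α ⟫)
    (trans (cong (ι (+ 2) *_) (inv-inverseˡ ⟪ α , α ⟫ α≢0)) (ℚP.*-identityʳ (ι (+ 2))))

  ⟨α,α⟩∨≡2 : ⟨ α , α ⟩∨ ≡ 1ℚ + 1ℚ
  ⟨α,α⟩∨≡2 = trans (⟨,⟩∨≡κ* α) κ*⟪α,α⟫≡2

  ⟨,⟩∨≡0⇒⟪,⟫≡0 : (v : V n) → ⟨ v , α ⟩∨ ≡ 0ℚ → ⟪ v , α ⟫ ≡ 0ℚ
  ⟨,⟩∨≡0⇒⟪,⟫≡0 v ⟨v,α⟩∨≡0 = begin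
    x                         ≡⟨ solve 1 (λ x → x := con ½ :* ((con 1ℚ :+ con 1ℚ) :* x)) refl x ⟩
    ½ * ((1ℚ + 1ℚ) * x)       ≡⟨ cong (λ c → ½ * (c * x)) (sym κ*⟪α,α⟫≡2) ⟩
    ½ * ((κ * a) * x)         ≡⟨ solve 3 (λ κ a x → con ½ :* ((κ :* a) :* x) := (con ½ :* a) :* (κ :* x)) refl κ a x ⟩
    (½ * a) * (κ * x)         ≡⟨ cong ((½ * a) *_) (trans (sym (⟨,⟩∨≡κ* v)) ⟨v,α⟩∨≡0) ⟩
    (½ * a) * 0ℚ              ≡⟨ ℚP.*-zeroʳ (½ * a) ⟩
    0ℚ                        ∎
    where
    open ≡-Reasoning
    x a : ℚ
    x = ⟪ v , α ⟫
    a = ⟪ α , α ⟫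

  ⟨½·,⟩∨≡1 : (u : V n) → ⟪ u , α ⟫ ≡ ⟪ α , α ⟫ → ⟨ ½ · u , α ⟩∨ ≡ 1ℚ
  ⟨½·,⟩∨≡1 u ⟪u,α⟫≡⟪α,α⟫ = begin
    ⟨ ½ · u , α ⟩∨     ≡⟨ ⟨,⟩∨-·ˡ ½ u α ⟩
    ½ * ⟨ u , α ⟩∨     ≡⟨ cong (½ *_) (trans (⟨,⟩∨≡κ* u) (cong (κ *_) ⟪u,α⟫≡⟪α,α⟫)) ⟩
    ½ * (κ * ⟪ α , α ⟫) ≡⟨ cong (½ *_) κ*⟪α,α⟫≡2 ⟩
    ½ * (1ℚ + 1ℚ)      ≡⟨ refl ⟩
    1ℚ                 ∎
    where open ≡-Reasoning

  ⟪s,⟫≡-⟪,⟫ : (v : V n) → ⟪ s α v , α ⟫ ≡ - ⟪ v , α ⟫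
  ⟪s,⟫≡-⟪,⟫ v = begin
    ⟪ s α v , α ⟫                       ≡⟨ ⟪,⟫-⊖ˡ v (⟨ v , α ⟩∨ · α) α ⟩
    x - ⟪ ⟨ v , α ⟩∨ · α , α ⟫          ≡⟨ cong (_-_ x) (⟪,⟫-·ˡ ⟨ v , α ⟩∨ α α) ⟩
    x - ⟨ v , α ⟩∨ * a                  ≡⟨ cong (λ t → x - t * a) (⟨,⟩∨≡κ* v) ⟩
    x - (κ * x) * a                     ≡⟨ solve 3 (λ x κ a → x :- (κ :* x) :* a := x :- (κ :* a) :* x) refl x κ a ⟩
    x - (κ * a) * x                     ≡⟨ cong (λ c → x - c * x) κ*⟪α,α⟫≡2 ⟩
    x - (1ℚ + 1ℚ) * x                   ≡⟨ solve 1 (λ x → x :- (con 1ℚ :+ con 1ℚ) :* x := :- x) refl x ⟩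
    - x                                 ∎
    where
    open ≡-Reasoning
    x a : ℚ
    x = ⟪ v , α ⟫
    a = ⟪ α , α ⟫

  ⟨s,⟩∨≡-⟨,⟩∨ : (v : V n) → ⟨ s α v , α ⟩∨ ≡ - ⟨ v , α ⟩∨
  ⟨s,⟩∨≡-⟨,⟩∨ v = begin
    ⟨ s α v , α ⟩∨     ≡⟨ ⟨,⟩∨≡κ* (s α v) ⟩
    κ * ⟪ s α v , α ⟫  ≡⟨ cong (κ *_) (⟪s,⟫≡-⟪,⟫ v) ⟩
    κ * - ⟪ v , α ⟫    ≡⟨ sym (ℚP.neg-distribʳ-* κ _) ⟩
    - (κ * ⟪ v , α ⟫)  ≡⟨ cong -_ (sym (⟨,⟩∨≡κ* v)) ⟩
    - ⟨ v , α ⟩∨       ∎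
    where open ≡-Reasoning

  s-involutive : (v : V n) → s α (s α v) ≡ v
  s-involutive v = trans (cong (λ t → s α v ⊖ t · α) (⟨s,⟩∨≡-⟨,⟩∨ v)) (⊖-⊖-neg ⟨ v , α ⟩∨ v α)

  s-injective : {u v : V n} → s α u ≡ s α v → u ≡ v
  s-injective {u} {v} su≡sv = trans (sym (s-involutive u)) (trans (cong (s α) su≡sv) (s-involutive v))

  s-self : s α α ≡ (- 1ℚ) · α
  s-self = trans (cong (λ t → α ⊖ t · α) ⟨α,α⟩∨≡2) (⊖-double α)

δ-diag : (i : Fin r) → δ i i ≡ 1ℚ
δ-diag i with i F.≟ i
... | yes _ = refl
... | no i≢i = ⊥-elim (i≢i refl)

δ-off : {i j : Fin r} → i ≢ j → δ i j ≡ 0ℚ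
δ-off {i = i} {j} i≢j with i F.≟ j
... | yes i≡j = ⊥-elim (i≢j i≡j)
... | no _ = refl

δℤ : Fin r → Fin r → ℤ
δℤ i j with i F.≟ j
... | yes _ = + 1
... | no _ = + 0

ι-δℤ : (i j : Fin r) → ι (δℤ i j) ≡ δ i j
ι-δℤ i j with i F.≟ j
... | yes _ = refl
... | no _ = refl

δℤ≥0 : (i j : Fin r) → + 0 ≤ δℤ i j
δℤ≥0 i j with i F.≟ j
... | yes _ = +≤+ z≤n
... | no _ = +≤+ z≤n

lincomb-cong : (Δ : Fin r → V n) {a b : Fin r → ℚ} → (∀ i → a i ≡ b i) → lincomb a Δ ≡ lincomb b Δ
lincomb-cong {r = zero} Δ a≗b = refl
lincomb-cong {r = suc r} Δ a≗b =
  cong₂ _⊕_ (cong (_· Δ F.zero) (a≗b F.zero)) (lincomb-cong (Δ ∘ F.suc) (a≗b ∘ F.suc))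

lincomb-+ : (a b : Fin r → ℚ) (Δ : Fin r → V n) →
  lincomb (λ i → a i + b i) Δ ≡ lincomb a Δ ⊕ lincomb b Δ
lincomb-+ {r = zero} a b Δ = sym (⊕-identityʳ 0V)
lincomb-+ {r = suc r} a b Δ = trans
  (cong₂ _⊕_ (·-distribʳ (a F.zero) (b F.zero) (Δ F.zero)) (lincomb-+ (a ∘ F.suc) (b ∘ F.suc) (Δ ∘ F.suc)))
  (⊕-interchange _ _ _ _)

lincomb-· : (q : ℚ) (a : Fin r → ℚ) (Δ : Fin r → V n) → q · lincomb a Δ ≡ lincomb (λ i → q * a i) Δ
lincomb-· {r = zero} q a Δ = ·-zeroʳ q
lincomb-· {r = suc r} q a Δ = trans (·-distribˡ q _ _)
  (cong₂ _⊕_ (·-assoc q (a F.zero) (Δ F.zero)) (lincomb-· q (a ∘ F.suc) (Δ ∘ F.suc)))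

lincomb-⊖ : (a b : Fin r → ℚ) (Δ : Fin r → V n) →
  lincomb (λ i → a i - b i) Δ ≡ lincomb a Δ ⊖ lincomb b Δ
lincomb-⊖ a b Δ = trans (lincomb-+ a (λ i → - b i) Δ) (cong (lincomb a Δ ⊕_) (begin
  lincomb (λ i → - b i) Δ           ≡⟨ lincomb-cong Δ (λ i → sym (-1*x≈-x (b i))) ⟩
  lincomb (λ i → - 1ℚ * b i) Δ      ≡⟨ sym (lincomb-· (- 1ℚ) b Δ) ⟩
  (- 1ℚ) · lincomb b Δ              ∎))
  where open ≡-Reasoning

lincomb-0 : (a : Fin r → ℚ) (Δ : Fin r → V n) → (∀ i → a i ≡ 0ℚ) → lincomb a Δ ≡ 0V
lincomb-0 {r = zero} a Δ a≗0 = refl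
lincomb-0 {r = suc r} a Δ a≗0 = trans
  (cong₂ _⊕_ (trans (cong (_· Δ F.zero) (a≗0 F.zero)) (·-zeroˡ _)) (lincomb-0 (a ∘ F.suc) (Δ ∘ F.suc) (a≗0 ∘ F.suc)))
  (⊕-identityˡ 0V)

lincomb-single : (a : Fin r → ℚ) (Δ : Fin r → V n) (j : Fin r) →
  (∀ i → i ≢ j → a i ≡ 0ℚ) → lincomb a Δ ≡ a j · Δ j
lincomb-single {r = suc r} a Δ F.zero a≗0 = trans
  (cong (a F.zero · Δ F.zero ⊕_) (lincomb-0 (a ∘ F.suc) (Δ ∘ F.suc) (λ i → a≗0 (F.suc i) (λ ()))))
  (⊕-identityʳ _)
lincomb-single {r = suc r} a Δ (F.suc j) a≗0 = trans
  (cong₂ _⊕_ (trans (cong (_· Δ F.zero) (a≗0 F.zero (λ ()))) (·-zeroˡ _))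
             (lincomb-single (a ∘ F.suc) (Δ ∘ F.suc) j (λ i i≢j → a≗0 (F.suc i) (i≢j ∘ FP.suc-injective))))
  (⊕-identityˡ _)

lincomb-δ : (Δ : Fin r → V n) (j : Fin r) → lincomb (λ i → δ i j) Δ ≡ Δ j
lincomb-δ Δ j = trans (lincomb-single (λ i → δ i j) Δ j (λ i → δ-off))
  (trans (cong (_· Δ j) (δ-diag j)) (·-identityˡ (Δ j)))

lincomb-⊖-· : (c : Fin r → ℚ) (Δ : Fin r → V n) (t : ℚ) (j : Fin r) →
  lincomb c Δ ⊖ t · Δ j ≡ lincomb (λ i → c i - t * δ i j) Δ
lincomb-⊖-· c Δ t j = begin
  lincomb c Δ ⊖ t · Δ j                         ≡⟨ cong (λ v → lincomb c Δ ⊖ t · v) (sym (lincomb-δ Δ j)) ⟩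
  lincomb c Δ ⊖ t · lincomb (λ i → δ i j) Δ     ≡⟨ cong (lincomb c Δ ⊖_) (lincomb-· t (λ i → δ i j) Δ) ⟩
  lincomb c Δ ⊖ lincomb (λ i → t * δ i j) Δ     ≡⟨ sym (lincomb-⊖ c (λ i → t * δ i j) Δ) ⟩
  lincomb (λ i → c i - t * δ i j) Δ             ∎
  where open ≡-Reasoning

lincomb-injective : (Δ : Fin r → V n) → (∀ c → lincomb c Δ ≡ 0V → ∀ i → c i ≡ 0ℚ) →
  (a b : Fin r → ℚ) → lincomb a Δ ≡ lincomb b Δ → ∀ i → a i ≡ b i
lincomb-injective Δ independent a b la≡lb i = begin
  a i                   ≡⟨ solve 2 (λ a b → a := (a :- b) :+ b) refl (a i) (b i) ⟩
  (a i - b i) + b i     ≡⟨ cong (_+ b i) (independent (λ i → a i - b i) la-b≡0 i) ⟩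
  0ℚ + b i              ≡⟨ ℚP.+-identityˡ (b i) ⟩
  b i                   ∎
  where
  open ≡-Reasoning
  la-b≡0 : lincomb (λ i → a i - b i) Δ ≡ 0V
  la-b≡0 = trans (lincomb-⊖ a b Δ) (trans (cong (lincomb a Δ ⊖_) (sym la≡lb)) (⊖-self _))

⟪,lincomb⟫≡0 : (w : V n) (c : Fin r → ℚ) (Δ : Fin r → V n) →
  (∀ i → ⟪ w , Δ i ⟫ ≡ 0ℚ) → ⟪ w , lincomb c Δ ⟫ ≡ 0ℚ
⟪,lincomb⟫≡0 {r = zero} w c Δ w⊥Δ = trans (⟪,⟫-comm w 0V) (⟪,⟫-0Vˡ w)
⟪,lincomb⟫≡0 {n = n} {r = suc r} w c Δ w⊥Δ = begin
  ⟪ w , c F.zero · Δ F.zero ⊕ rest ⟫                 ≡⟨ ⟪,⟫-⊕ʳ w _ rest ⟩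
  ⟪ w , c F.zero · Δ F.zero ⟫ + ⟪ w , rest ⟫          ≡⟨ cong₂ _+_ head≡0 (⟪,lincomb⟫≡0 w (c ∘ F.suc) (Δ ∘ F.suc) (w⊥Δ ∘ F.suc)) ⟩
  0ℚ + 0ℚ                                            ≡⟨ refl ⟩
  0ℚ                                                 ∎
  where
  open ≡-Reasoning
  rest : V n
  rest = lincomb (c ∘ F.suc) (Δ ∘ F.suc)
  head≡0 : ⟪ w , c F.zero · Δ F.zero ⟫ ≡ 0ℚ
  head≡0 = trans (⟪,⟫-·ʳ (c F.zero) w (Δ F.zero)) (trans (cong (c F.zero *_) (w⊥Δ F.zero)) (ℚP.*-zeroʳ (c F.zero)))

-- Sums over reflection-stable lists

_≟V_ : (u v : V n) → Dec (u ≡ v)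
_≟V_ = VecP.≡-dec ℚP._≟_

sumℚ : List ℚ → ℚ
sumℚ = foldr _+_ 0ℚ

sumℚ-↭ : {xs ys : List ℚ} → xs ↭ ys → sumℚ xs ≡ sumℚ ys
sumℚ-↭ xs↭ys = foldr-commMonoid (setoid ℚ) ℚP.+-0-isCommutativeMonoid (↭⇒↭ₛ xs↭ys)

sumℚ-map-sameElements : (f : V n → ℚ) {xs ys : List (V n)} → Unique xs → Unique ys →
  (∀ {z} → z ∈ xs ⇔ z ∈ ys) → sumℚ (map f xs) ≡ sumℚ (map f ys)
sumℚ-map-sameElements f xs! ys! xs⇔ys = sumℚ-↭ (map⁺ f (∼bag⇒↭ (unique∧set⇒bag xs! ys! xs⇔ys)))

sumℚ-neg : (xs : List ℚ) → sumℚ (map -_ xs) ≡ - sumℚ xs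
sumℚ-neg [] = refl
sumℚ-neg (x ∷ xs) = trans (cong (_+_ (- x)) (sumℚ-neg xs)) (sym (ℚP.neg-distrib-+ x (sumℚ xs)))

⟪sumL,⟫≡sumℚ : (S : List (V n)) (α : V n) → ⟪ sumL S , α ⟫ ≡ sumℚ (map ⟪_, α ⟫ S)
⟪sumL,⟫≡sumℚ [] α = ⟪,⟫-0Vˡ α
⟪sumL,⟫≡sumℚ (β ∷ S) α = trans (⟪,⟫-⊕ˡ β (sumL S) α) (cong (_+_ ⟪ β , α ⟫) (⟪sumL,⟫≡sumℚ S α))

sumℚ-pairings-reflection-stable≡0 : (α : V n) → ⟪ α , α ⟫ ≢ 0ℚ → {T : List (V n)} → Unique T →
  (∀ {β} → β ∈ T → s α β ∈ T) → sumℚ (map ⟪_, α ⟫ T) ≡ 0ℚ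
sumℚ-pairings-reflection-stable≡0 {n = n} α α≢0 {T} T! sT⊆T = x≡-x⇒x≡0 _ (begin
  sumℚ (map f T)                ≡⟨ sumℚ-map-sameElements f T! (UniqueP.map⁺ s-injective T!) (mk⇔ into-sT from-sT) ⟩
  sumℚ (map f (map (s α) T))    ≡⟨ cong sumℚ (sym (ListP.map-∘ T)) ⟩
  sumℚ (map (f ∘ s α) T)        ≡⟨ cong sumℚ (ListP.map-cong ⟪s,⟫≡-⟪,⟫ T) ⟩
  sumℚ (map (-_ ∘ f) T)         ≡⟨ cong sumℚ (ListP.map-∘ T) ⟩
  sumℚ (map -_ (map f T))       ≡⟨ sumℚ-neg (map f T) ⟩
  - sumℚ (map f T)              ∎)
  where
  open ≡-Reasoning
  open Coroot α α≢0
  f : V n → ℚ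
  f = ⟪_, α ⟫
  into-sT : ∀ {z} → z ∈ T → z ∈ map (s α) T
  into-sT {z} z∈T = subst (_∈ map (s α) T) (s-involutive z) (∈-map⁺ (s α) (sT⊆T z∈T))
  from-sT : ∀ {z} → z ∈ map (s α) T → z ∈ T
  from-sT z∈sT with ∈-map⁻ (s α) z∈sT
  ... | β , β∈T , refl = sT⊆T β∈T

⟨½sumL,⟩∨≡1 : (α : V n) → ⟪ α , α ⟫ ≢ 0ℚ → {S : List (V n)} → Unique S → α ∈ S → (- 1ℚ) · α ∉ S →
  (∀ {β} → β ∈ S → β ≢ α → s α β ∈ S) → ⟨ ½ · sumL S , α ⟩∨ ≡ 1ℚ
⟨½sumL,⟩∨≡1 {n = n} α α≢0 {S} S! α∈S -α∉S sS⊆S = ⟨½·,⟩∨≡1 (sumL S) (begin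
  ⟪ sumL S , α ⟫                ≡⟨ ⟪sumL,⟫≡sumℚ S α ⟩
  sumℚ (map f S)                ≡⟨ sumℚ-map-sameElements f S! α∷T! (mk⇔ into-α∷T from-α∷T) ⟩
  f α + sumℚ (map f T)          ≡⟨ cong (_+_ (f α)) (sumℚ-pairings-reflection-stable≡0 α α≢0 (UniqueP.filter⁺ ≢α? S!) sT⊆T) ⟩
  f α + 0ℚ                      ≡⟨ ℚP.+-identityʳ (f α) ⟩
  ⟪ α , α ⟫                     ∎)
  where
  open ≡-Reasoning
  open Coroot α α≢0
  f : V n → ℚ
  f = ⟪_, α ⟫
  ≢α? : (β : V n) → Dec (β ≢ α)
  ≢α? β = ¬? (β ≟V α)
  T : List (V n)
  T = filter ≢α? S
  α∷T! : Unique (α ∷ T)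
  α∷T! = tabulate (λ β∈T α≡β → proj₂ (∈-filter⁻ ≢α? {xs = S} β∈T) (sym α≡β)) ∷ UniqueP.filter⁺ ≢α? S!
  into-α∷T : ∀ {z} → z ∈ S → z ∈ α ∷ T
  into-α∷T {z} z∈S with z ≟V α
  ... | yes z≡α = here z≡α
  ... | no z≢α = there (∈-filter⁺ ≢α? z∈S z≢α)
  from-α∷T : ∀ {z} → z ∈ α ∷ T → z ∈ S
  from-α∷T (here refl) = α∈S
  from-α∷T (there z∈T) = proj₁ (∈-filter⁻ ≢α? {xs = S} z∈T)
  sT⊆T : ∀ {β} → β ∈ T → s α β ∈ T
  sT⊆T {β} β∈T with ∈-filter⁻ ≢α? {xs = S} β∈T
  ... | β∈S , β≢α = ∈-filter⁺ ≢α? (sS⊆S β∈S β≢α) sβ≢α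
    where
    sβ≢α : s α β ≢ α
    sβ≢α sβ≡α = -α∉S (subst (_∈ S) (trans (sym (s-involutive β)) (trans (cong (s α) sβ≡α) s-self)) β∈S)

-- Positive roots and simple reflections

module PositiveRoots {n r : ℕ} {Φ : List (V n)} (Φ-rootSystem : IsRootSystem Φ)
  {Δ : Fin r → V n} (Δ-base : IsFundamentalSystem Φ Δ)
  {Φ⁺ : List (V n)} (Φ⁺-spec : ∀ α → (α ∈ Φ⁺) ⇔ ((α ∈ Φ) × NonnegComb Δ α)) where

  open IsRootSystem Φ-rootSystem
  open IsFundamentalSystem Δ-base

  root≢0 : ∀ {β} → β ∈ Φ → ⟪ β , β ⟫ ≢ 0ℚ
  root≢0 {β} β∈Φ ⟪β,β⟫≡0 = zero∉ (subst (_∈ Φ) (⟪v,v⟫≡0⇒v≡0V β ⟪β,β⟫≡0) β∈Φ)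

  Φ⁺⊆Φ : ∀ {β} → β ∈ Φ⁺ → β ∈ Φ
  Φ⁺⊆Φ {β} β∈Φ⁺ = proj₁ (Equivalence.to (Φ⁺-spec β) β∈Φ⁺)

  root∈span : ∀ {β} → β ∈ Φ → InSpan Δ β
  root∈span β∈Φ with signed β∈Φ
  ... | inj₁ (c , _ , β≡) = (λ i → ι (c i)) , β≡
  ... | inj₂ (c , _ , β≡) = (λ i → ι (c i)) , β≡

  simple∈Φ⁺ : ∀ j → Δ j ∈ Φ⁺
  simple∈Φ⁺ j = Equivalence.from (Φ⁺-spec (Δ j))
    (inΦ j , (λ i → δℤ i j) , (λ i → δℤ≥0 i j) ,
     sym (trans (lincomb-cong Δ (λ i → ι-δℤ i j)) (lincomb-δ Δ j)))

  neg-simple∉Φ⁺ : ∀ j → (- 1ℚ) · Δ j ∉ Φ⁺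
  neg-simple∉Φ⁺ j -Δj∈Φ⁺ with proj₂ (Equivalence.to (Φ⁺-spec _) -Δj∈Φ⁺)
  ... | c , c≥0 , -Δj≡ = 0≰-1 (subst (0ℚ ≤ℚ_) cj≡-1 (ι-nonneg (c j) (c≥0 j)))
    where
    -Δj≡lincomb : (- 1ℚ) · Δ j ≡ lincomb (λ i → - 1ℚ * δ i j) Δ
    -Δj≡lincomb = trans (cong ((- 1ℚ) ·_) (sym (lincomb-δ Δ j))) (lincomb-· (- 1ℚ) (λ i → δ i j) Δ)
    cj≡-1 : ι (c j) ≡ - 1ℚ
    cj≡-1 = trans (lincomb-injective Δ linInd (λ i → ι (c i)) (λ i → - 1ℚ * δ i j) (trans (sym -Δj≡) -Δj≡lincomb) j)
      (trans (cong (- 1ℚ *_) (δ-diag j)) (ℚP.*-identityʳ (- 1ℚ)))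

  s-simple-nonneg : ∀ j {β} → β ∈ Φ → NonnegComb Δ β → β ≢ Δ j → NonnegComb Δ (s (Δ j) β)
  s-simple-nonneg j {β} β∈Φ (c , c≥0 , β≡) β≢Δj with signed (reflect (inΦ j) β∈Φ)
  ... | inj₁ sβ-nonneg = sβ-nonneg
  ... | inj₂ (d , d≤0 , sβ≡) = ⊥-elim (not±1 (reduced (ι (c j)) (inΦ j) (subst (_∈ Φ) β≡cjΔj β∈Φ)))
    where
    t : ℚ
    t = ⟨ β , Δ j ⟩∨
    d≡c-tδ : ∀ i → ι (d i) ≡ ι (c i) - t * δ i j
    d≡c-tδ = lincomb-injective Δ linInd (λ i → ι (d i)) (λ i → ι (c i) - t * δ i j)
      (trans (sym sβ≡) (trans (cong (_⊖ t · Δ j) β≡) (lincomb-⊖-· (λ i → ι (c i)) Δ t j)))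
    -- off j, the coefficients of β and s_j β agree, and have opposite signs
    c≡0 : ∀ i → i ≢ j → ι (c i) ≡ 0ℚ
    c≡0 i i≢j = ℚP.≤-antisym (subst (_≤ℚ 0ℚ) di≡ci (ι-nonpos (d i) (d≤0 i))) (ι-nonneg (c i) (c≥0 i))
      where
      di≡ci : ι (d i) ≡ ι (c i)
      di≡ci = trans (d≡c-tδ i) (trans (cong (λ x → ι (c i) - t * x) (δ-off i≢j))
        (solve 2 (λ x t → x :- t :* con 0ℚ := x) refl (ι (c i)) t))
    β≡cjΔj : β ≡ ι (c j) · Δ j
    β≡cjΔj = trans β≡ (lincomb-single (λ i → ι (c i)) Δ j c≡0)
    not±1 : (ι (c j) ≡ 1ℚ) ⊎ (ι (c j) ≡ - 1ℚ) → ⊥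
    not±1 (inj₁ cj≡1) = β≢Δj (trans β≡cjΔj (trans (cong (_· Δ j) cj≡1) (·-identityˡ (Δ j))))
    not±1 (inj₂ cj≡-1) = 0≰-1 (subst (0ℚ ≤ℚ_) cj≡-1 (ι-nonneg (c j) (c≥0 j)))

  s-simple-stable : ∀ j {β} → β ∈ Φ⁺ → β ≢ Δ j → s (Δ j) β ∈ Φ⁺
  s-simple-stable j {β} β∈Φ⁺ β≢Δj with Equivalence.to (Φ⁺-spec β) β∈Φ⁺
  ... | β∈Φ , β-nonneg = Equivalence.from (Φ⁺-spec _)
    (reflect (inΦ j) β∈Φ , s-simple-nonneg j β∈Φ β-nonneg β≢Δj)

  ⟨½sumL,simple⟩∨≡1 : ∀ j {S} → Unique S → Δ j ∈ S → (∀ {β} → β ∈ S → β ∈ Φ⁺) →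
    (∀ {β} → β ∈ S → β ≢ Δ j → s (Δ j) β ∈ S) → ⟨ ½ · sumL S , Δ j ⟩∨ ≡ 1ℚ
  ⟨½sumL,simple⟩∨≡1 j S! Δj∈S S⊆Φ⁺ sS⊆S =
    ⟨½sumL,⟩∨≡1 (Δ j) (root≢0 (inΦ j)) S! Δj∈S (neg-simple∉Φ⁺ j ∘ S⊆Φ⁺) sS⊆S

  module FundamentalWeight (Φ⁺! : Unique Φ⁺) (λw : Fin r → V n)
    (λw-dual : ∀ i j → ⟨ λw i , Δ j ⟩∨ ≡ δ i j) (p : Fin r) where

    λp : V n
    λp = λw p

    ⟨ρ,simple⟩∨≡1 : ∀ j → ⟨ ρ Φ⁺ , Δ j ⟩∨ ≡ 1ℚ
    ⟨ρ,simple⟩∨≡1 j = ⟨½sumL,simple⟩∨≡1 j Φ⁺! (simple∈Φ⁺ j) (λ β∈Φ⁺ → β∈Φ⁺) (s-simple-stable j)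

    λp⊥simple : ∀ j → j ≢ p → ⟪ λp , Δ j ⟫ ≡ 0ℚ
    λp⊥simple j j≢p = Coroot.⟨,⟩∨≡0⇒⟪,⟫≡0 (Δ j) (root≢0 (inΦ j)) λp
      (trans (λw-dual p j) (δ-off (j≢p ∘ sym)))

    λp-orthogonal? : (β : V n) → Dec (⟨ λp , β ⟩∨ ≡ 0ℚ)
    λp-orthogonal? β = ⟨ λp , β ⟩∨ ℚP.≟ 0ℚ

    ⟨ρp,simple⟩∨≡1 : ∀ j → j ≢ p → ⟨ ρp λp Φ⁺ , Δ j ⟩∨ ≡ 1ℚ
    ⟨ρp,simple⟩∨≡1 j j≢p = ⟨½sumL,simple⟩∨≡1 j (UniqueP.filter⁺ λp-orthogonal? Φ⁺!)
      (∈-filter⁺ λp-orthogonal? (simple∈Φ⁺ j) (⟪,⟫≡0⇒⟨,⟩∨≡0 λp (Δ j) (λp⊥simple j j≢p)))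
      (proj₁ ∘ ∈-filter⁻ λp-orthogonal? {xs = Φ⁺}) s-stable
      where
      s-stable : ∀ {β} → β ∈ Φp⁺ λp Φ⁺ → β ≢ Δ j → s (Δ j) β ∈ Φp⁺ λp Φ⁺
      s-stable {β} β∈Φp⁺ β≢Δj with ∈-filter⁻ λp-orthogonal? {xs = Φ⁺} β∈Φp⁺
      ... | β∈Φ⁺ , ⟨λp,β⟩∨≡0 = ∈-filter⁺ λp-orthogonal? (s-simple-stable j β∈Φ⁺ β≢Δj)
        (⟪,⟫≡0⇒⟨,⟩∨≡0 λp _ (trans (⟪,s⟫≡⟪,⟫ λp (Δ j) β (λp⊥simple j j≢p))
          (Coroot.⟨,⟩∨≡0⇒⟪,⟫≡0 β (root≢0 (Φ⁺⊆Φ β∈Φ⁺)) λp ⟨λp,β⟩∨≡0)))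

    ½cp : ℚ
    ½cp = ½ * cp λp (Δ p) Φ⁺

    ρ-ρp-½cpλp : V n
    ρ-ρp-½cpλp = (ρ Φ⁺ ⊖ ρp λp Φ⁺) ⊖ ½cp · λp

    ⟨ρ-ρp-½cpλp,⟩∨ : ∀ γ → ⟨ ρ-ρp-½cpλp , γ ⟩∨ ≡ (⟨ ρ Φ⁺ , γ ⟩∨ - ⟨ ρp λp Φ⁺ , γ ⟩∨) - ½cp * ⟨ λp , γ ⟩∨
    ⟨ρ-ρp-½cpλp,⟩∨ γ = trans (⟨,⟩∨-⊖ˡ (ρ Φ⁺ ⊖ ρp λp Φ⁺) (½cp · λp) γ)
      (cong₂ _-_ (⟨,⟩∨-⊖ˡ (ρ Φ⁺) (ρp λp Φ⁺) γ) (⟨,⟩∨-·ˡ ½cp λp γ))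

    ⟨ρ-ρp-½cpλp,simple⟩∨≡0 : ∀ i → ⟨ ρ-ρp-½cpλp , Δ i ⟩∨ ≡ 0ℚ
    ⟨ρ-ρp-½cpλp,simple⟩∨≡0 i with i F.≟ p
    ... | yes refl = begin
      ⟨ ρ-ρp-½cpλp , Δ p ⟩∨                               ≡⟨ ⟨ρ-ρp-½cpλp,⟩∨ (Δ p) ⟩
      (⟨ ρ Φ⁺ , Δ p ⟩∨ - P) - ½ * C * ⟨ λp , Δ p ⟩∨       ≡⟨ cong₂ (λ x y → (x - P) - ½ * C * y) (⟨ρ,simple⟩∨≡1 p) ⟨λp,αp⟩∨≡1 ⟩
      (1ℚ - P) - ½ * C * 1ℚ                                ≡⟨ cong (λ c → (1ℚ - P) - ½ * c * 1ℚ) C≡2[1-P] ⟩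
      (1ℚ - P) - ½ * ((1ℚ + 1ℚ) * (1ℚ - P)) * 1ℚ           ≡⟨ solve 1 (λ P → (con 1ℚ :- P) :- con ½ :* ((con 1ℚ :+ con 1ℚ) :* (con 1ℚ :- P)) :* con 1ℚ := con 0ℚ) refl P ⟩
      0ℚ                                                   ∎
      where
      open ≡-Reasoning
      P C : ℚ
      P = ⟨ ρp λp Φ⁺ , Δ p ⟩∨
      C = cp λp (Δ p) Φ⁺
      ⟨λp,αp⟩∨≡1 : ⟨ λp , Δ p ⟩∨ ≡ 1ℚ
      ⟨λp,αp⟩∨≡1 = trans (λw-dual p p) (δ-diag p)
      C≡2[1-P] : C ≡ (1ℚ + 1ℚ) * (1ℚ - P)
      C≡2[1-P] = cong ((1ℚ + 1ℚ) *_) (trans (⟨,⟩∨-⊖ˡ λp (ρp λp Φ⁺) (Δ p)) (cong (_- P) ⟨λp,αp⟩∨≡1))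
    ... | no i≢p = begin
      ⟨ ρ-ρp-½cpλp , Δ i ⟩∨                                       ≡⟨ ⟨ρ-ρp-½cpλp,⟩∨ (Δ i) ⟩
      (⟨ ρ Φ⁺ , Δ i ⟩∨ - ⟨ ρp λp Φ⁺ , Δ i ⟩∨) - ½cp * ⟨ λp , Δ i ⟩∨ ≡⟨ cong₂ (λ x y → x - ½cp * y)
                                                                        (cong₂ _-_ (⟨ρ,simple⟩∨≡1 i) (⟨ρp,simple⟩∨≡1 i i≢p))
                                                                        (trans (λw-dual p i) (δ-off (i≢p ∘ sym))) ⟩
      (1ℚ - 1ℚ) - ½cp * 0ℚ                                         ≡⟨ solve 1 (λ c → (con 1ℚ :- con 1ℚ) :- c :* con 0ℚ := con 0ℚ) refl ½cp ⟩
      0ℚ                                                           ∎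
      where open ≡-Reasoning

    ρ-ρp-½cpλp⊥root : ∀ {α} → α ∈ Φ → ⟨ ρ-ρp-½cpλp , α ⟩∨ ≡ 0ℚ
    ρ-ρp-½cpλp⊥root {α} α∈Φ with root∈span α∈Φ
    ... | c , α≡ = ⟪,⟫≡0⇒⟨,⟩∨≡0 ρ-ρp-½cpλp α
      (subst (λ v → ⟪ ρ-ρp-½cpλp , v ⟫ ≡ 0ℚ) (sym α≡) (⟪,lincomb⟫≡0 ρ-ρp-½cpλp c Δ ⊥simple))
      where
      ⊥simple : ∀ i → ⟪ ρ-ρp-½cpλp , Δ i ⟫ ≡ 0ℚ
      ⊥simple i = Coroot.⟨,⟩∨≡0⇒⟪,⟫≡0 (Δ i) (root≢0 (inΦ i)) ρ-ρp-½cpλp (⟨ρ-ρp-½cpλp,simple⟩∨≡0 i)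

    ⟨ρ,root⟩∨-split : ∀ {α} → α ∈ Φ → ⟨ ρ Φ⁺ , α ⟩∨ ≡ ⟨ ρp λp Φ⁺ , α ⟩∨ + ½cp * ⟨ λp , α ⟩∨
    ⟨ρ,root⟩∨-split {α} α∈Φ = begin
      R                          ≡⟨ solve 3 (λ R P X → R := ((R :- P) :- X) :+ (P :+ X)) refl R P X ⟩
      ((R - P) - X) + (P + X)    ≡⟨ cong (_+ (P + X)) (trans (sym (⟨ρ-ρp-½cpλp,⟩∨ α)) (ρ-ρp-½cpλp⊥root α∈Φ)) ⟩
      0ℚ + (P + X)               ≡⟨ ℚP.+-identityˡ (P + X) ⟩
      P + X                      ∎
      where
      open ≡-Reasoning
      R P X : ℚ
      R = ⟨ ρ Φ⁺ , α ⟩∨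
      P = ⟨ ρp λp Φ⁺ , α ⟩∨
      X = ½cp * ⟨ λp , α ⟩∨

split-consequences : (K H P C : ℚ) → H ≡ P + ½ * C * K →
  ((m : ℤ) → ι (+ 2) * P ≡ ι m → ι (+ 2) * H ≡ K * C + ι m)
  × (H < ½ * (K * C) → P < 0ℚ)
  × (½ * (K * C) < H → 0ℚ < P)
split-consequences K H P C H≡ = twice , below , above
  where
  X : ℚ
  X = ½ * (K * C)
  P≡H-X : P ≡ H - X
  P≡H-X = trans (solve 3 (λ P C K → P := (P :+ con ½ :* C :* K) :- con ½ :* (K :* C)) refl P C K)
    (cong (_- X) (sym H≡))
  X-X≡0 : X - X ≡ 0ℚ
  X-X≡0 = ℚP.+-inverseʳ X
  twice : (m : ℤ) → ι (+ 2) * P ≡ ι m → ι (+ 2) * H ≡ K * C + ι m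
  twice m 2P≡m = trans (cong (ι (+ 2) *_) H≡)
    (trans (solve 3 (λ P C K → (con 1ℚ :+ con 1ℚ) :* (P :+ con ½ :* C :* K) := K :* C :+ (con 1ℚ :+ con 1ℚ) :* P) refl P C K)
      (cong (_+_ (K * C)) 2P≡m))
  below : H < X → P < 0ℚ
  below H<X = subst₂ _<_ (sym P≡H-X) X-X≡0 (ℚP.+-monoˡ-< (- X) H<X)
  above : X < H → 0ℚ < P
  above X<H = subst₂ _<_ X-X≡0 (sym P≡H-X) (ℚP.+-monoˡ-< (- X) X<H)

-- The identity holds for every root α.
lemma8p13 : ∀ {n r : ℕ} (Φ : List (V n)) → Unique Φ → IsRootSystem Φ → Irreducible Φ →
    (Δ : Fin r → V n) → IsFundamentalSystem Φ Δ →
    (Φ⁺ : List (V n)) → Unique Φ⁺ → (∀ α → (α ∈ Φ⁺) ⇔ ((α ∈ Φ) × NonnegComb Δ α)) →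
    (λw : Fin r → V n) → (∀ i → InSpan Δ (λw i)) → (∀ i j → ⟨ λw i , Δ j ⟩∨ ≡ δ i j) →
    (p : Fin r) → (k h : ℤ) → + 1 ≤ k →
    ∀ {α} → α ∈ Φ → ⟨ λw p , α ⟩∨ ≡ ι k → ⟨ ρ Φ⁺ , α ⟩∨ ≡ ι h →
    ((m : ℤ) → ι (+ 2) * ⟨ ρp (λw p) Φ⁺ , α ⟩∨ ≡ ι m →
      ι (+ 2) * ι h ≡ ι k * cp (λw p) (Δ p) Φ⁺ + ι m)
    × (ι h < ½ * (ι k * cp (λw p) (Δ p) Φ⁺) → ⟨ ρp (λw p) Φ⁺ , α ⟩∨ < 0ℚ)
    × (½ * (ι k * cp (λw p) (Δ p) Φ⁺) < ι h → 0ℚ < ⟨ ρp (λw p) Φ⁺ , α ⟩∨)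
lemma8p13 Φ _ Φ-rootSystem _ Δ Δ-base Φ⁺ Φ⁺! Φ⁺-spec λw _ λw-dual p k h _ {α} α∈Φ ⟨λp,α⟩∨≡k ⟨ρ,α⟩∨≡h =
  split-consequences (ι k) (ι h) ⟨ ρp (λw p) Φ⁺ , α ⟩∨ (cp (λw p) (Δ p) Φ⁺) (begin
    ι h                                                      ≡⟨ sym ⟨ρ,α⟩∨≡h ⟩
    ⟨ ρ Φ⁺ , α ⟩∨                                            ≡⟨ ⟨ρ,root⟩∨-split α∈Φ ⟩
    ⟨ ρp (λw p) Φ⁺ , α ⟩∨ + ½cp * ⟨ λw p , α ⟩∨              ≡⟨ cong (λ x → ⟨ ρp (λw p) Φ⁺ , α ⟩∨ + ½cp * x) ⟨λp,α⟩∨≡k ⟩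
    ⟨ ρp (λw p) Φ⁺ , α ⟩∨ + ½cp * ι k                        ∎)
  where
  open ≡-Reasoning
  open PositiveRoots.FundamentalWeight Φ-rootSystem Δ-base Φ⁺-spec Φ⁺! λw λw-dual p
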